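{- For every graph $G$, $2^{\mathrm{nd}(G)} \le \beta(G)$. Moreover, there is an absolute constant $c$ such that every graph $G$ with $n \ge 2$ vertices satisfies $\beta(G) \le n^{c\cdot \mathrm{nd}(G)}$ (i.e., $\beta(G) \le n^{O(\mathrm{nd}(G))}$).
   Context: The neighbor-depth $\mathrm{nd}(G)$ is defined recursively: $\mathrm{nd}(G)=0$ iff $V(G)=\emptyset$; if $G$ is disconnected, $\mathrm{nd}(G)$ is the maximum of $\mathrm{nd}$ over its connected components; if $G$ is non-empty and connected, $\mathrm{nd}(G)\le k$ iff there is $v\in V(G)$ with $\mathrm{nd}(G\setminus N[v])\le k-1$ and $\mathrm{nd}(G\setminus\{v\})\le k$ ($N[v]$ the closed neighborhood, $G\setminus X = G[V(G)\setminus X]$). An independent set branching tree on $G$ is a rooted binary tree whose nodes are labeled by induced subgraphs of $G$ such that the root is labeled $G$, every leaf is labeled with the empty graph, and every non-leaf node labeled $G[X]$ is either a branching node, having two children labeled $G[X\setminus N[v]]$ and $G[X\setminus\{v\}]$ for some $v\in X$, or a decomposition node, having two children labeled $G[C_1]$ and $G[C_2]$ where $(C_1,C_2)$ is a partition of $X$ into two non-empty parts with no edges between them. $\beta(G)$ is the minimum number of nodes of an independent set branching tree on $G$. -}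

module Defs where

open import Data.Nat using (ℕ; zero; suc; _+_; _≤_)
open import Data.Bool using (Bool; true; false; _∨_; if_then_else_)
open import Data.Fin using (Fin; _≟_)
open import Data.Fin.Subset using (Subset; _∈_; _∉_; _⊆_; _─_; _-_; Empty; Nonempty; inside; outside)
open import Data.Vec using (tabulate)
open import Data.Product using (Σ; _×_; ∃)
open import Data.Sum using (_⊎_)
open import Relation.Nullary using (¬_; does)
open import Relation.Binary.PropositionalEquality using (_≡_)

record Graph (n : ℕ) : Set where
  field
    adj   : Fin n → Fin n → Bool
    sym   : ∀ u v → adj u v ≡ adj v u
    irrefl : ∀ v → adj v v ≡ false
open Graph public

Adj : ∀ {n} → Graph n → Fin n → Fin n → Set
Adj G u v = adj G u v ≡ true

N[_]_ : ∀ {n} → Fin n → Graph n → Subset n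
N[ v ] G = tabulate (λ u → if does (u ≟ v) ∨ adj G v u then inside else outside)

module _ {n : ℕ} (G : Graph n) where

  data Reach (X : Subset n) (u : Fin n) : Fin n → Set where
    here : u ∈ X → Reach X u u
    step : ∀ {w v} → Reach X u w → Adj G w v → v ∈ X → Reach X u v

  Connected : Subset n → Set
  Connected X = Nonempty X × (∀ u v → u ∈ X → v ∈ X → Reach X u v)

  Component : Subset n → Subset n → Set
  Component X C = C ⊆ X × Connected C
                × (∀ D → C ⊆ D → D ⊆ X → Connected D → D ⊆ C)

  -- NdLe X k  means  nd(G[X]) ≤ k  (least relation closed under the
  -- recursive clauses of the definition).
  data NdLe : Subset n → ℕ → Set where
    nd-empty : ∀ {X k} → Empty X → NdLe X k
    nd-disc  : ∀ {X k} → Nonempty X → ¬ Connected X →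
               (∀ C → Component X C → NdLe C k) → NdLe X k
    nd-conn  : ∀ {X k} → Connected X → (v : Fin n) → v ∈ X →
               NdLe (X ─ (N[ v ] G)) k → NdLe (X - v) (suc k) →
               NdLe X (suc k)

  IsNd : Subset n → ℕ → Set
  IsNd X d = NdLe X d × (∀ k → NdLe X k → d ≤ k)

  NoEdgeBetween : Subset n → Subset n → Set
  NoEdgeBetween A B = ∀ u v → u ∈ A → v ∈ B → ¬ Adj G u v

  SplitOf : Subset n → Subset n → Subset n → Set
  SplitOf X C₁ C₂ = (∀ u → u ∈ X → u ∈ C₁ ⊎ u ∈ C₂)
                  × C₁ ⊆ X × C₂ ⊆ X
                  × (∀ u → u ∈ C₁ → u ∉ C₂)
                  × Nonempty C₁ × Nonempty C₂
                  × NoEdgeBetween C₁ C₂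

  data BTree : Subset n → Set where
    leaf   : ∀ {X} → Empty X → BTree X
    branch : ∀ {X} (v : Fin n) → v ∈ X →
             BTree (X ─ (N[ v ] G)) → BTree (X - v) → BTree X
    decomp : ∀ {X} (C₁ C₂ : Subset n) → SplitOf X C₁ C₂ →
             BTree C₁ → BTree C₂ → BTree X

  size : ∀ {X} → BTree X → ℕ
  size (leaf _)           = 1
  size (branch _ _ l r)   = suc (size l + size r)
  size (decomp _ _ _ l r) = suc (size l + size r)

-- Lower bound: by induction on a branching tree for G[X] there is k ≥ nd(G[X]) with
-- 2^k ≤ size. At a branching node on v, nd(X) ≤ max(1 + nd(X ∖ N[v]), nd(X ∖ v)), and since
-- nd is monotone under taking induced subgraphs, nd(X ∖ N[v]) ≤ nd(X ∖ v); hence 2^nd(X) is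
-- at most 2^nd(X ∖ N[v]) + 2^nd(X ∖ v). At a decomposition node nd(X) ≤ max(nd(C₁), nd(C₂)).
-- Upper bound: follow a derivation of nd(X) ≤ k, branching on the vertex it provides or
-- splitting off one connected component at a time; the resulting tree satisfies
-- size + 1 ≤ 2(|X| + 1)^(k+1). Branching needs 2|X|^k + 2|X|^(k+1) ≤ 2(|X| + 1)^(k+1), and
-- splitting needs superadditivity of m ↦ 2(m + 1)^(k+1) on m ≥ 1, which holds as k ≥ 1.
-- Finally 2(n + 1)^(d+1) ≤ n^(5d) for n ≥ 2 and d ≥ 1.
module Submission where

open import Defs
open import Data.Nat using (ℕ; _≤_; _^_; _*_)
open import Data.Fin.Subset using (⊤)
open import Data.Product using (Σ; _×_; ∃)

open import Data.Nat using (zero; suc; _+_; _<_; _⊔_; z≤n; s≤s; _≤?_)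
open import Data.Nat.Properties
  using (≤-refl; ≤-reflexive; ≤-trans; ≤-<-trans; <-≤-trans; m<1+n⇒m≤n; ≰⇒>; n≤1+n; m≤m+n; m≤n+m;
         m≤m⊔n; m≤n⊔m; ⊔-sel; +-suc; +-mono-≤; *-monoʳ-≤; *-monoˡ-≤; *-mono-≤;
         *-identityˡ; *-distribˡ-+; m^n>0; ^-monoˡ-≤; ^-monoʳ-≤; ^-*-assoc; ^-distribˡ-+-*;
         module ≤-Reasoning)
open import Data.Nat.Tactic.RingSolver using (solve-∀)
open import Data.Bool using (true; false; _∨_; if_then_else_)
open import Data.Bool.Properties using () renaming (_≟_ to _≟ᵇ_)
open import Data.Fin as Fin using (Fin; _≟_)
open import Data.Fin.Properties using (any?)
open import Data.Fin.Subset using (Subset; _∈_; _∉_; _⊆_; _─_; _-_; Nonempty; ∣_∣; ⁅_⁆)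
open import Data.Fin.Subset.Properties
  using (_∈?_; nonempty?; x∈p∧x≢y⇒x∈p-y; x∈p∧x∉q⇒x∈p─q; p─q⊆p; x∈p⇒∣p-x∣<∣p∣; p⊆q⇒∣p∣≤∣q∣;
         ⊆-trans; drop-∷-⊆; ∣p∣≤n; ∈⊤; ∣⊤∣≡n; p⊂q⇒∣p∣<∣q∣; p∩q≢∅⇒∣p─q∣<∣p∣; x∈p∩q⁺)
open import Data.Vec using ([]; _∷_; tabulate; here; there)
open import Data.Vec.Properties using (lookup∘tabulate; []=⇒lookup; lookup⇒[]=)
open import Data.Product using (_,_; ∃-syntax)
open import Data.Sum using (_⊎_; inj₁; inj₂; swap)
open import Data.Empty using (⊥-elim)
open import Relation.Nullary using (¬_; Dec; yes; no; does)
open import Relation.Nullary.Decidable using (_×-dec_; ¬?; map′; dec-true)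
open import Relation.Binary.PropositionalEquality
  using (_≡_; refl; trans; cong) renaming (sym to ≡-sym)

does⇒ : ∀ {a} {A : Set a} (a? : Dec A) → does a? ≡ true → A
does⇒ (yes a) _ = a

private
  variable
    m : ℕ

∈-tabulate-does⁺ : ∀ {P : Fin m → Set} (P? : ∀ x → Dec (P x)) {x} →
                   P x → x ∈ tabulate (λ y → does (P? y))
∈-tabulate-does⁺ P? {x} px = lookup⇒[]= x _ (trans (lookup∘tabulate _ x) (dec-true (P? x) px))

∈-tabulate-does⁻ : ∀ {P : Fin m → Set} (P? : ∀ x → Dec (P x)) {x} →
                   x ∈ tabulate (λ y → does (P? y)) → P x
∈-tabulate-does⁻ P? {x} x∈ = does⇒ (P? x) (trans (≡-sym (lookup∘tabulate _ x)) ([]=⇒lookup x∈))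

x∈p─q⇒x∉q : ∀ {x : Fin m} (p q : Subset m) → x ∈ p ─ q → x ∉ q
x∈p─q⇒x∉q (_ ∷ p) (_ ∷ q)    (there x∈p─q) (there x∈q) = x∈p─q⇒x∉q p q x∈p─q x∈q
x∈p─q⇒x∉q (_ ∷ p) (true ∷ q) ()            here

─-monoˡ : ∀ {p q : Subset m} (r : Subset m) → p ⊆ q → p ─ r ⊆ q ─ r
─-monoˡ {p = p} r p⊆q x∈ = x∈p∧x∉q⇒x∈p─q (p⊆q (p─q⊆p p r x∈)) (x∈p─q⇒x∉q p r x∈)

x∉p∧p⊆q⇒p⊆q-x : ∀ {x} {p q : Subset m} → x ∉ p → p ⊆ q → p ⊆ q - x
x∉p∧p⊆q⇒p⊆q-x x∉p p⊆q y∈p = x∈p∧x≢y⇒x∈p-y (p⊆q y∈p) (λ { refl → x∉p y∈p })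

x∈p⇒∣p∣>0 : ∀ {x} {p : Subset m} → x ∈ p → 0 < ∣ p ∣
x∈p⇒∣p∣>0 {p = p} x∈p = ≤-<-trans z≤n (x∈p⇒∣p-x∣<∣p∣ {p = p} x∈p)

∣p∣+∣q─p∣≡∣q∣ : ∀ {p q : Subset m} → p ⊆ q → ∣ p ∣ + ∣ q ─ p ∣ ≡ ∣ q ∣
∣p∣+∣q─p∣≡∣q∣ {p = []}        {[]}        _   = refl
∣p∣+∣q─p∣≡∣q∣ {p = true ∷ p}  {true ∷ q}  p⊆q = cong suc (∣p∣+∣q─p∣≡∣q∣ (drop-∷-⊆ p⊆q))
∣p∣+∣q─p∣≡∣q∣ {p = true ∷ p}  {false ∷ q} p⊆q with () ← p⊆q here
∣p∣+∣q─p∣≡∣q∣ {p = false ∷ p} {true ∷ q}  p⊆q =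
  trans (+-suc ∣ p ∣ _) (cong suc (∣p∣+∣q─p∣≡∣q∣ (drop-∷-⊆ p⊆q)))
∣p∣+∣q─p∣≡∣q∣ {p = false ∷ p} {false ∷ q} p⊆q = ∣p∣+∣q─p∣≡∣q∣ (drop-∷-⊆ p⊆q)

^-⊔≤+ : ∀ b i j → b ^ (i ⊔ j) ≤ b ^ i + b ^ j
^-⊔≤+ b i j with ⊔-sel i j
... | inj₁ i⊔j≡i rewrite i⊔j≡i = m≤m+n (b ^ i) (b ^ j)
... | inj₂ i⊔j≡j rewrite i⊔j≡j = m≤n+m (b ^ j) (b ^ i)

2^1+i≤2^j+2^i : ∀ {i j} → i ≤ j → 2 ^ suc i ≤ 2 ^ j + 2 ^ i
2^1+i≤2^j+2^i {i} {j} i≤j = begin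
  2 * 2 ^ i     ≡⟨ cong (2 ^ i +_) (*-identityˡ (2 ^ i)) ⟩
  2 ^ i + 2 ^ i ≤⟨ +-mono-≤ (^-monoʳ-≤ 2 i≤j) ≤-refl ⟩
  2 ^ j + 2 ^ i ∎
  where open ≤-Reasoning

2+m+n≡1+m+1+n : ∀ a b → suc (suc (a + b)) ≡ suc a + suc b
2+m+n≡1+m+1+n a b = cong suc (≡-sym (+-suc a b))

-- With x = 1 + a and y = 1 + b this is (x + 1)^p + (y + 1)^p ≤ (x + y + 1)^p for p ≥ 2.
^-superadditive : ∀ a b p → (2 + a) ^ (2 + p) + (2 + b) ^ (2 + p) ≤ (2 + a + (1 + b)) ^ (2 + p)
^-superadditive a b zero = ≤-trans (m≤m+n _ _) (≤-reflexive (≡-sym (square-expansion a b)))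
  where
  square-expansion : ∀ a b → (2 + a + (1 + b)) * ((2 + a + (1 + b)) * 1)
                           ≡ (2 + a) * ((2 + a) * 1) + (2 + b) * ((2 + b) * 1)
                             + (1 + 2 * a * b + 2 * a + 2 * b)
  square-expansion = solve-∀
^-superadditive a b (suc p) = begin
  x * x ^ (2 + p) + y * y ^ (2 + p) ≤⟨ +-mono-≤ (*-monoˡ-≤ (x ^ (2 + p)) x≤z) (*-monoˡ-≤ (y ^ (2 + p)) y≤z) ⟩
  z * x ^ (2 + p) + z * y ^ (2 + p) ≡⟨ *-distribˡ-+ z (x ^ (2 + p)) (y ^ (2 + p)) ⟨
  z * (x ^ (2 + p) + y ^ (2 + p))   ≤⟨ *-monoʳ-≤ z (^-superadditive a b p) ⟩
  z * z ^ (2 + p)                   ∎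
  where
  open ≤-Reasoning
  x = 2 + a
  y = 2 + b
  z = 2 + a + (1 + b)
  x≤z : x ≤ z
  x≤z = m≤m+n x (1 + b)
  y≤z : y ≤ z
  y≤z = s≤s (m≤n+m (suc b) (suc a))

treeBound : ℕ → ℕ → ℕ
treeBound m k = 2 * suc m ^ suc k

treeBound≥2 : ∀ m k → 2 ≤ treeBound m k
treeBound≥2 m k = *-monoʳ-≤ 2 (m^n>0 (suc m) (suc k))

treeBound-superadditive : ∀ {a b} k → 0 < a → 0 < b →
                          treeBound a (suc k) + treeBound b (suc k) ≤ treeBound (a + b) (suc k)
treeBound-superadditive {suc a} {suc b} k _ _ =
  ≤-trans (≤-reflexive (≡-sym (*-distribˡ-+ 2 ((2 + a) ^ (2 + k)) ((2 + b) ^ (2 + k)))))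
          (*-monoʳ-≤ 2 (^-superadditive a b k))

treeBound-branch : ∀ {a b m} k → a < m → b < m →
                   treeBound a k + treeBound b (suc k) ≤ treeBound m (suc k)
treeBound-branch {a} {b} {m} k a<m b<m = begin
  2 * suc a ^ suc k + 2 * suc b ^ (2 + k) ≤⟨ +-mono-≤ (*-monoʳ-≤ 2 (^-monoˡ-≤ (suc k) a<m))
                                                     (*-monoʳ-≤ 2 (^-monoˡ-≤ (2 + k) b<m)) ⟩
  2 * m ^ suc k + 2 * m ^ (2 + k)         ≡⟨ *-distribˡ-+ 2 (m ^ suc k) (m ^ (2 + k)) ⟨
  2 * (suc m * m ^ suc k)                 ≤⟨ *-monoʳ-≤ 2 (*-monoʳ-≤ (suc m) (^-monoˡ-≤ (suc k) (n≤1+n m))) ⟩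
  2 * suc m ^ (2 + k)                     ∎
  where open ≤-Reasoning

treeBound≤^ : ∀ {n} k → 2 ≤ n → treeBound n (suc k) ≤ n ^ (5 * suc k)
treeBound≤^ {suc (suc m)} k (s≤s (s≤s z≤n)) = begin
  2 * suc n ^ (2 + k)     ≤⟨ *-mono-≤ 2≤n^1 (^-monoˡ-≤ (2 + k) 1+n≤n^2) ⟩
  n ^ 1 * (n ^ 2) ^ (2 + k) ≡⟨ cong (n ^ 1 *_) (^-*-assoc n 2 (2 + k)) ⟩
  n ^ 1 * n ^ (2 * (2 + k)) ≡⟨ ^-distribˡ-+-* n 1 (2 * (2 + k)) ⟨
  n ^ (1 + 2 * (2 + k))     ≤⟨ ^-monoʳ-≤ n exponent≤ ⟩
  n ^ (5 * suc k)           ∎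
  where
  open ≤-Reasoning
  n = 2 + m
  square : ∀ m → (2 + m) * ((2 + m) * 1) ≡ suc (2 + m) + (1 + 3 * m + m * m)
  square = solve-∀
  2≤n^1 : 2 ≤ n ^ 1
  2≤n^1 = s≤s (s≤s z≤n)
  1+n≤n^2 : suc n ≤ n ^ 2
  1+n≤n^2 = ≤-trans (m≤m+n (suc n) _) (≤-reflexive (≡-sym (square m)))
  exponents : ∀ k → 5 * suc k ≡ 1 + 2 * (2 + k) + 3 * k
  exponents = solve-∀
  exponent≤ : 1 + 2 * (2 + k) ≤ 5 * suc k
  exponent≤ = ≤-trans (m≤m+n (1 + 2 * (2 + k)) (3 * k)) (≤-reflexive (≡-sym (exponents k)))

module _ {n : ℕ} (G : Graph n) where

  adj? : ∀ u v → Dec (Adj G u v)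
  adj? u v = adj G u v ≟ᵇ true

  Adj-sym : ∀ {u v} → Adj G u v → Adj G v u
  Adj-sym {u} {v} = trans (sym G v u)

  v∈N[v] : ∀ v → v ∈ N[ v ] G
  v∈N[v] v = lookup⇒[]= v _ (trans (lookup∘tabulate _ v) entry≡true)
    where
    entry≡true : (if does (v ≟ v) ∨ adj G v v then true else false) ≡ true
    entry≡true with v ≟ v
    ... | yes _  = refl
    ... | no v≢v = ⊥-elim (v≢v refl)

  X─N[v]⊆X-v : ∀ X v → X ─ N[ v ] G ⊆ X - v
  X─N[v]⊆X-v X v x∈ = x∈p∧x≢y⇒x∈p-y (p─q⊆p X _ x∈) (λ { refl → x∈p─q⇒x∉q X _ x∈ (v∈N[v] v) })

  Reach⇒source∈ : ∀ {X u v} → Reach G X u v → u ∈ X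
  Reach⇒source∈ (here u∈)     = u∈
  Reach⇒source∈ (step r _ _) = Reach⇒source∈ r

  Reach⇒target∈ : ∀ {X u v} → Reach G X u v → v ∈ X
  Reach⇒target∈ (here v∈)     = v∈
  Reach⇒target∈ (step _ _ v∈) = v∈

  Reach-trans : ∀ {X u w v} → Reach G X u w → Reach G X w v → Reach G X u v
  Reach-trans r (here _)      = r
  Reach-trans r (step s a v∈) = step (Reach-trans r s) a v∈

  Reach-sym : ∀ {X u v} → Reach G X u v → Reach G X v u
  Reach-sym (here u∈)      = here u∈
  Reach-sym (step r a v∈) = Reach-trans (step (here v∈) (Adj-sym a) (Reach⇒target∈ r)) (Reach-sym r)

  Reach-mono : ∀ {X Y u v} → X ⊆ Y → Reach G X u v → Reach G Y u v
  Reach-mono X⊆Y (here u∈)      = here (X⊆Y u∈)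
  Reach-mono X⊆Y (step r a v∈) = step (Reach-mono X⊆Y r) a (X⊆Y v∈)

  Reach-view : ∀ {X u v} → Reach G X u v → u ≡ v ⊎ ∃[ w ] Adj G u w × w ∈ X × Reach G (X - u) w v
  Reach-view (here _) = inj₁ refl
  Reach-view {u = u} (step {v = v} r a v∈) with Reach-view r | v ≟ u
  ... | _                       | yes v≡u = inj₁ (≡-sym v≡u)
  ... | inj₁ refl               | no v≢u  = inj₂ (v , a , v∈ , here (x∈p∧x≢y⇒x∈p-y v∈ v≢u))
  ... | inj₂ (w , uw , w∈ , r′) | no v≢u  = inj₂ (w , uw , w∈ , step r′ a (x∈p∧x≢y⇒x∈p-y v∈ v≢u))

  reach? : ∀ {f} X → ∣ X ∣ ≤ f → ∀ u v → Dec (Reach G X u v)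
  reach? X ∣X∣≤f u v with u ∈? X
  ... | no u∉ = no (λ r → u∉ (Reach⇒source∈ r))
  ... | yes u∈ with u ≟ v
  ...   | yes refl = yes (here u∈)
  reach? {zero} X ∣X∣≤f u v | yes u∈ | no _ with () ← ≤-trans (x∈p⇒∣p∣>0 {p = X} u∈) ∣X∣≤f
  reach? {suc f} X ∣X∣≤f u v | yes u∈ | no u≢v =
    map′ (λ (w , uw , w∈ , r) → Reach-trans (step (here u∈) uw w∈) (Reach-mono (p─q⊆p X _) r))
         first-step
         (any? (λ w → adj? u w ×-dec (w ∈? X ×-dec reach? (X - u) ∣X-u∣≤f w v)))
    where
    ∣X-u∣≤f : ∣ X - u ∣ ≤ f
    ∣X-u∣≤f = m<1+n⇒m≤n (<-≤-trans (x∈p⇒∣p-x∣<∣p∣ {p = X} u∈) ∣X∣≤f)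
    first-step : Reach G X u v → ∃[ w ] Adj G u w × w ∈ X × Reach G (X - u) w v
    first-step r with Reach-view r
    ... | inj₁ u≡v = ⊥-elim (u≢v u≡v)
    ... | inj₂ w   = w

  componentOf : Subset n → Fin n → Subset n
  componentOf X u = tabulate (λ v → does (reach? X (∣p∣≤n X) u v))

  Reach⇒∈componentOf : ∀ {X u v} → Reach G X u v → v ∈ componentOf X u
  Reach⇒∈componentOf {X} {u} = ∈-tabulate-does⁺ (reach? X (∣p∣≤n X) u)

  ∈componentOf⇒Reach : ∀ {X u v} → v ∈ componentOf X u → Reach G X u v
  ∈componentOf⇒Reach {X} {u} = ∈-tabulate-does⁻ (reach? X (∣p∣≤n X) u)

  componentOf⊆ : ∀ {X u} → componentOf X u ⊆ X
  componentOf⊆ {X} {u} v∈ = Reach⇒target∈ (∈componentOf⇒Reach {X} {u} v∈)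

  u∈componentOf : ∀ {X u} → u ∈ X → u ∈ componentOf X u
  u∈componentOf {X} {u} u∈ = Reach⇒∈componentOf {X} {u} (here u∈)

  Reach-within-componentOf : ∀ {X u v} → Reach G X u v → Reach G (componentOf X u) u v
  Reach-within-componentOf (here u∈)      = here (u∈componentOf u∈)
  Reach-within-componentOf (step r a v∈) =
    step (Reach-within-componentOf r) a (Reach⇒∈componentOf (step r a v∈))

  Connected⇒⊆componentOf : ∀ {X D u} → Connected G D → D ⊆ X → u ∈ D → D ⊆ componentOf X u
  Connected⇒⊆componentOf (_ , reach) D⊆X u∈ v∈ = Reach⇒∈componentOf (Reach-mono D⊆X (reach _ _ u∈ v∈))

  componentOf-Component : ∀ {X u} → u ∈ X → Component G X (componentOf X u)
  componentOf-Component {X} {u} u∈ =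
    componentOf⊆ {X} {u} ,
    ((u , u∈componentOf u∈) , λ a b a∈ b∈ → Reach-trans (Reach-sym (reach-within a∈)) (reach-within b∈)) ,
    λ D C⊆D D⊆X cD → Connected⇒⊆componentOf cD D⊆X (C⊆D (u∈componentOf u∈))
    where
    reach-within : ∀ {v} → v ∈ componentOf X u → Reach G (componentOf X u) u v
    reach-within v∈ = Reach-within-componentOf (∈componentOf⇒Reach {X} {u} v∈)

  Connected⇒Component : ∀ {X} → Connected G X → Component G X X
  Connected⇒Component cX = (λ x∈ → x∈) , cX , λ _ _ D⊆X _ → D⊆X

  Connected⊎escapes : ∀ {X u} → u ∈ X → Connected G X ⊎ Nonempty (X ─ componentOf X u)
  Connected⊎escapes {X} {u} u∈ with any? (λ w → w ∈? X ×-dec ¬? (w ∈? componentOf X u))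
  ... | yes (w , w∈ , w∉) = inj₂ (w , x∈p∧x∉q⇒x∈p─q w∈ w∉)
  ... | no none = inj₁ ((u , u∈) , λ a b a∈ b∈ → Reach-trans (Reach-sym (reaches a∈)) (reaches b∈))
    where
    reaches : ∀ {v} → v ∈ X → Reach G X u v
    reaches {v} v∈ with v ∈? componentOf X u
    ... | yes v∈C = ∈componentOf⇒Reach {X} {u} v∈C
    ... | no v∉C  = ⊥-elim (none (v , v∈ , v∉C))

  escapes⇒¬Connected : ∀ {X u} → u ∈ X → Nonempty (X ─ componentOf X u) → ¬ Connected G X
  escapes⇒¬Connected {X} u∈ (w , w∈) (_ , reach) =
    x∈p─q⇒x∉q X _ w∈ (Reach⇒∈componentOf (reach _ w u∈ (p─q⊆p X _ w∈)))

  componentOf-split : ∀ {X u} → u ∈ X → Nonempty (X ─ componentOf X u) →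
                      SplitOf G X (componentOf X u) (X ─ componentOf X u)
  componentOf-split {X} {u} u∈ escape =
    cover , componentOf⊆ {X} {u} , p─q⊆p X C , (λ v v∈C v∈X─C → x∈p─q⇒x∉q X C v∈X─C v∈C) ,
    (u , u∈componentOf u∈) , escape , no-edge
    where
    C = componentOf X u
    cover : ∀ v → v ∈ X → v ∈ C ⊎ v ∈ X ─ C
    cover v v∈ with v ∈? C
    ... | yes v∈C = inj₁ v∈C
    ... | no v∉C  = inj₂ (x∈p∧x∉q⇒x∈p─q v∈ v∉C)
    no-edge : NoEdgeBetween G C (X ─ C)
    no-edge a b a∈C b∈X─C ab = x∈p─q⇒x∉q X C b∈X─C
      (Reach⇒∈componentOf (step (∈componentOf⇒Reach {X} {u} a∈C) ab (p─q⊆p X C b∈X─C)))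

  Reach-stays-in-side : ∀ {X A B u v} → (∀ w → w ∈ X → w ∈ A ⊎ w ∈ B) → NoEdgeBetween G A B →
                        u ∈ A → Reach G X u v → v ∈ A
  Reach-stays-in-side cover no-edge u∈A (here _) = u∈A
  Reach-stays-in-side cover no-edge u∈A (step {w} {v} r a v∈) with cover v v∈
  ... | inj₁ v∈A = v∈A
  ... | inj₂ v∈B = ⊥-elim (no-edge w v (Reach-stays-in-side cover no-edge u∈A r) v∈B a)

  ndLe-mono : ∀ {X k l} → NdLe G X k → k ≤ l → NdLe G X l
  ndLe-mono (nd-empty e)         _         = nd-empty e
  ndLe-mono (nd-disc ne nc H)    k≤l       = nd-disc ne nc (λ C c → ndLe-mono (H C c) k≤l)
  ndLe-mono (nd-conn c v v∈ l r) (s≤s k≤l) = nd-conn c v v∈ (ndLe-mono l k≤l) (ndLe-mono r (s≤s k≤l))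

  ¬ndLe-zero : ∀ {X} → Nonempty X → ¬ NdLe G X 0
  ¬ndLe-zero ne       (nd-empty e)    = e ne
  ¬ndLe-zero (u , u∈) (nd-disc _ _ H) =
    ¬ndLe-zero (u , u∈componentOf u∈) (H _ (componentOf-Component u∈))

  ndLe-components : ∀ {X k} → (∀ C → Component G X C → NdLe G C k) → NdLe G X k
  ndLe-components {X} H with nonempty? X
  ... | no e = nd-empty e
  ... | yes (u , u∈) with Connected⊎escapes u∈
  ...   | inj₁ cX     = H X (Connected⇒Component cX)
  ...   | inj₂ escape = nd-disc (u , u∈) (escapes⇒¬Connected u∈ escape) H

  mutual
    ndLe-⊆ : ∀ {X Y k} → NdLe G X k → Y ⊆ X → NdLe G Y k
    ndLe-⊆ nd Y⊆X = ndLe-components (λ D (D⊆Y , cD , _) → ndLe-⊆-connected nd cD (⊆-trans D⊆Y Y⊆X))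

    ndLe-⊆-connected : ∀ {X D k} → NdLe G X k → Connected G D → D ⊆ X → NdLe G D k
    ndLe-⊆-connected (nd-empty e) ((u , u∈) , _) D⊆X = ⊥-elim (e (u , D⊆X u∈))
    ndLe-⊆-connected (nd-disc _ _ H) cD@((u , u∈) , _) D⊆X =
      ndLe-⊆-connected (H _ (componentOf-Component (D⊆X u∈))) cD (Connected⇒⊆componentOf cD D⊆X u∈)
    ndLe-⊆-connected (nd-conn _ v _ l r) cD D⊆X = ndLe-branch-connected l r cD D⊆X

    ndLe-branch-connected : ∀ {X D k v} → NdLe G (X ─ N[ v ] G) k → NdLe G (X - v) (suc k) →
                            Connected G D → D ⊆ X → NdLe G D (suc k)
    ndLe-branch-connected {D = D} {v = v} l r cD D⊆X with v ∈? D
    ... | yes v∈D = nd-conn cD v v∈D (ndLe-⊆ l (─-monoˡ (N[ v ] G) D⊆X)) (ndLe-⊆ r (─-monoˡ ⁅ v ⁆ D⊆X))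
    ... | no v∉D  = ndLe-⊆-connected r cD (x∉p∧p⊆q⇒p⊆q-x v∉D D⊆X)

  ndLe-branch : ∀ {X k} v → NdLe G (X ─ N[ v ] G) k → NdLe G (X - v) (suc k) → NdLe G X (suc k)
  ndLe-branch v l r = ndLe-components (λ D (D⊆X , cD , _) → ndLe-branch-connected l r cD D⊆X)

  ndLe-split : ∀ {X A B k} → SplitOf G X A B → NdLe G A k → NdLe G B k → NdLe G X k
  ndLe-split {X} {A} {B} {k} (cover , _ , _ , _ , _ , _ , no-edge) ndA ndB = ndLe-components on-component
    where
    on-component : ∀ D → Component G X D → NdLe G D k
    on-component D (D⊆X , cD@((u , u∈) , reach) , _) with cover u (D⊆X u∈)
    ... | inj₁ u∈A = ndLe-⊆-connected ndA cD (λ v∈ →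
      Reach-stays-in-side cover no-edge u∈A (Reach-mono D⊆X (reach u _ u∈ v∈)))
    ... | inj₂ u∈B = ndLe-⊆-connected ndB cD (λ v∈ →
      Reach-stays-in-side (λ w w∈ → swap (cover w w∈)) (λ a b a∈B b∈A ab → no-edge b a b∈A a∈B (Adj-sym ab))
                          u∈B (Reach-mono D⊆X (reach u _ u∈ v∈)))

  Nd≤log₂ : Subset n → ℕ → Set
  Nd≤log₂ X s = ∃[ k ] NdLe G X k × 2 ^ k ≤ s

  Nd≤log₂-branch : ∀ {X kₗ kᵣ} v → NdLe G (X ─ N[ v ] G) kₗ → NdLe G (X - v) kᵣ →
                   Nd≤log₂ X (2 ^ kₗ + 2 ^ kᵣ)
  Nd≤log₂-branch {X} {kₗ} {kᵣ} v ndₗ ndᵣ with kᵣ ≤? kₗ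
  ... | yes kᵣ≤kₗ =
    suc kᵣ , ndLe-branch v (ndLe-⊆ ndᵣ (X─N[v]⊆X-v X v)) (ndLe-mono ndᵣ (n≤1+n kᵣ)) , 2^1+i≤2^j+2^i kᵣ≤kₗ
  ... | no kᵣ≰kₗ with ≰⇒> kᵣ≰kₗ
  ...   | s≤s kₗ≤k = kᵣ , ndLe-branch v (ndLe-mono ndₗ kₗ≤k) ndᵣ , m≤n+m (2 ^ kᵣ) (2 ^ kₗ)

  Nd≤log₂-split : ∀ {X A B kₐ k_b} → SplitOf G X A B → NdLe G A kₐ → NdLe G B k_b →
                  Nd≤log₂ X (2 ^ kₐ + 2 ^ k_b)
  Nd≤log₂-split {kₐ = kₐ} {k_b} split ndA ndB =
    kₐ ⊔ k_b , ndLe-split split (ndLe-mono ndA (m≤m⊔n kₐ k_b)) (ndLe-mono ndB (m≤n⊔m kₐ k_b)) , ^-⊔≤+ 2 kₐ k_b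

  Nd≤log₂-node : ∀ {X Y Z sₗ sᵣ} → Nd≤log₂ Y sₗ → Nd≤log₂ Z sᵣ →
                 (∀ {kₗ kᵣ} → NdLe G Y kₗ → NdLe G Z kᵣ → Nd≤log₂ X (2 ^ kₗ + 2 ^ kᵣ)) →
                 Nd≤log₂ X (suc (sₗ + sᵣ))
  Nd≤log₂-node (kₗ , ndₗ , 2^kₗ≤sₗ) (kᵣ , ndᵣ , 2^kᵣ≤sᵣ) combine with combine ndₗ ndᵣ
  ... | k , nd , 2^k≤ = k , nd , ≤-trans 2^k≤ (≤-trans (+-mono-≤ 2^kₗ≤sₗ 2^kᵣ≤sᵣ) (n≤1+n _))

  Nd≤log₂-size : ∀ {X} (T : BTree G X) → Nd≤log₂ X (size G T)
  Nd≤log₂-size (leaf e)               = 0 , nd-empty e , ≤-refl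
  Nd≤log₂-size (branch v _ l r)       = Nd≤log₂-node (Nd≤log₂-size l) (Nd≤log₂-size r) (Nd≤log₂-branch v)
  Nd≤log₂-size (decomp _ _ split l r) = Nd≤log₂-node (Nd≤log₂-size l) (Nd≤log₂-size r) (Nd≤log₂-split split)

  ∣X─N[v]∣<∣X∣ : ∀ {X v} → v ∈ X → ∣ X ─ N[ v ] G ∣ < ∣ X ∣
  ∣X─N[v]∣<∣X∣ {X} {v} v∈ = ≤-<-trans (p⊆q⇒∣p∣≤∣q∣ (X─N[v]⊆X-v X v)) (x∈p⇒∣p-x∣<∣p∣ {p = X} v∈)

  SmallTree : Subset n → ℕ → Set
  SmallTree X k = Σ (BTree G X) λ T → suc (size G T) ≤ treeBound ∣ X ∣ k

  SmallTree-branch : ∀ {X k v} → v ∈ X → SmallTree (X ─ N[ v ] G) k → SmallTree (X - v) (suc k) →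
                     SmallTree X (suc k)
  SmallTree-branch {X} {k} {v} v∈ (Tₗ , boundₗ) (Tᵣ , boundᵣ) = branch v v∈ Tₗ Tᵣ , bound
    where
    open ≤-Reasoning
    bound : suc (suc (size G Tₗ + size G Tᵣ)) ≤ treeBound ∣ X ∣ (suc k)
    bound = begin
      suc (suc (size G Tₗ + size G Tᵣ))
        ≡⟨ 2+m+n≡1+m+1+n (size G Tₗ) (size G Tᵣ) ⟩
      suc (size G Tₗ) + suc (size G Tᵣ)
        ≤⟨ +-mono-≤ boundₗ boundᵣ ⟩
      treeBound (∣ X ─ N[ v ] G ∣) k + treeBound (∣ X - v ∣) (suc k)
        ≤⟨ treeBound-branch k (∣X─N[v]∣<∣X∣ v∈) (x∈p⇒∣p-x∣<∣p∣ {p = X} v∈) ⟩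
      treeBound ∣ X ∣ (suc k)
        ∎

  SmallTree-split : ∀ {X C k} → SplitOf G X C (X ─ C) → SmallTree C (suc k) → SmallTree (X ─ C) (suc k) →
                    SmallTree X (suc k)
  SmallTree-split {X} {C} {k} split@(_ , C⊆X , _ , _ , (_ , u∈) , (_ , w∈) , _) (Tₗ , boundₗ) (Tᵣ , boundᵣ) =
    decomp C (X ─ C) split Tₗ Tᵣ , bound
    where
    open ≤-Reasoning
    bound : suc (suc (size G Tₗ + size G Tᵣ)) ≤ treeBound ∣ X ∣ (suc k)
    bound = begin
      suc (suc (size G Tₗ + size G Tᵣ))
        ≡⟨ 2+m+n≡1+m+1+n (size G Tₗ) (size G Tᵣ) ⟩
      suc (size G Tₗ) + suc (size G Tᵣ)
        ≤⟨ +-mono-≤ boundₗ boundᵣ ⟩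
      treeBound (∣ C ∣) (suc k) + treeBound (∣ X ─ C ∣) (suc k)
        ≤⟨ treeBound-superadditive k (x∈p⇒∣p∣>0 u∈) (x∈p⇒∣p∣>0 w∈) ⟩
      treeBound (∣ C ∣ + ∣ X ─ C ∣) (suc k)
        ≡⟨ cong (λ m → treeBound m (suc k)) (∣p∣+∣q─p∣≡∣q∣ C⊆X) ⟩
      treeBound ∣ X ∣ (suc k)
        ∎

  -- The recursion is on a bound for ∣ X ∣, since the split case recurses on restrictions of
  -- the same derivation rather than on a subderivation.
  SmallTree-of-ndLe : ∀ f {X k} → NdLe G X k → ∣ X ∣ ≤ f → SmallTree X k
  SmallTree-of-ndLe _ {X} {k} (nd-empty e) _ = leaf e , treeBound≥2 ∣ X ∣ k
  SmallTree-of-ndLe zero {X} (nd-disc (_ , u∈) _ _) ∣X∣≤0 with () ← ≤-trans (x∈p⇒∣p∣>0 {p = X} u∈) ∣X∣≤0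
  SmallTree-of-ndLe zero {X} (nd-conn _ _ v∈ _ _)   ∣X∣≤0 with () ← ≤-trans (x∈p⇒∣p∣>0 {p = X} v∈) ∣X∣≤0
  SmallTree-of-ndLe (suc f) {k = zero} nd@(nd-disc ne _ _) _ = ⊥-elim (¬ndLe-zero ne nd)
  SmallTree-of-ndLe (suc f) {X} {suc k} nd@(nd-disc (u , u∈) ¬cX _) ∣X∣≤1+f with Connected⊎escapes u∈
  ... | inj₁ cX = ⊥-elim (¬cX cX)
  ... | inj₂ escape@(w , w∈X─C) =
    SmallTree-split {X} {C} {k} (componentOf-split u∈ escape)
      (SmallTree-of-ndLe f (ndLe-⊆ nd C⊆X) (m<1+n⇒m≤n (<-≤-trans ∣C∣<∣X∣ ∣X∣≤1+f)))
      (SmallTree-of-ndLe f (ndLe-⊆ nd (p─q⊆p X C)) (m<1+n⇒m≤n (<-≤-trans ∣X─C∣<∣X∣ ∣X∣≤1+f)))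
    where
    C : Subset n
    C = componentOf X u
    C⊆X : C ⊆ X
    C⊆X = componentOf⊆ {X} {u}
    ∣C∣<∣X∣ : ∣ C ∣ < ∣ X ∣
    ∣C∣<∣X∣ = p⊂q⇒∣p∣<∣q∣ (C⊆X , w , p─q⊆p X C w∈X─C , x∈p─q⇒x∉q X C w∈X─C)
    ∣X─C∣<∣X∣ : ∣ X ─ C ∣ < ∣ X ∣
    ∣X─C∣<∣X∣ = p∩q≢∅⇒∣p─q∣<∣p∣ X C (u , x∈p∩q⁺ (u∈ , u∈componentOf u∈))
  SmallTree-of-ndLe (suc f) {X} {suc k} (nd-conn _ v v∈ l r) ∣X∣≤1+f =
    SmallTree-branch {X} {k} v∈
      (SmallTree-of-ndLe f l (m<1+n⇒m≤n (<-≤-trans (∣X─N[v]∣<∣X∣ v∈) ∣X∣≤1+f)))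
      (SmallTree-of-ndLe f r (m<1+n⇒m≤n (<-≤-trans (x∈p⇒∣p-x∣<∣p∣ {p = X} v∈) ∣X∣≤1+f)))

2^nd≤size : ∀ {n X d} (G : Graph n) → IsNd G X d → (T : BTree G X) → 2 ^ d ≤ size G T
2^nd≤size G (_ , minimal) T with Nd≤log₂-size G T
... | k , nd≤k , 2^k≤size = ≤-trans (^-monoʳ-≤ 2 (minimal k nd≤k)) 2^k≤size

BTree-size≤n^5nd : ∀ {n d} → 2 ≤ n → (G : Graph n) → IsNd G ⊤ d →
                   Σ (BTree G ⊤) (λ T → size G T ≤ n ^ (5 * d))
BTree-size≤n^5nd {d = zero} (s≤s (s≤s z≤n)) G (nd , _) = ⊥-elim (¬ndLe-zero G (Fin.zero , ∈⊤) nd)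
BTree-size≤n^5nd {n} {suc d} 2≤n G (nd , _) with SmallTree-of-ndLe G n nd (≤-reflexive (∣⊤∣≡n n))
... | T , bound = T , (begin
  size G T                         ≤⟨ n≤1+n (size G T) ⟩
  suc (size G T)                   ≤⟨ bound ⟩
  treeBound (∣ ⊤ {n} ∣) (suc d)    ≡⟨ cong (λ m → treeBound m (suc d)) (∣⊤∣≡n n) ⟩
  treeBound n (suc d)              ≤⟨ treeBound≤^ d 2≤n ⟩
  n ^ (5 * suc d)                  ∎)
  where open ≤-Reasoning

theorem5 : ((n : ℕ) (G : Graph n) (d : ℕ) → IsNd G ⊤ d →
               (T : BTree G ⊤) → 2 ^ d ≤ size G T)
             × Σ ℕ (λ c → (n : ℕ) → 2 ≤ n → (G : Graph n) (d : ℕ) → IsNd G ⊤ d →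
               Σ (BTree G ⊤) (λ T → size G T ≤ n ^ (c * d)))
theorem5 = (λ _ G _ → 2^nd≤size G) , 5 , λ _ 2≤n G _ → BTree-size≤n^5nd 2≤n G
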